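{- Let $d\geq 1$ be an integer. Every $d$-degenerate graph $G$ with $n$ vertices and $m\geq\binom{d}{2}$ edges has at most \[n+\frac{(2^d-1)m}{d}-\frac{(d-3)2^d+d+1}{2}\] cliques.
   Context: All graphs are finite, simple and undirected. A graph is $d$-degenerate if every subgraph of it has a vertex of degree at most $d$. A clique is a (possibly empty) set of pairwise adjacent vertices; the number of cliques counts $\emptyset$ and single vertices. -}

module Defs where

open import Data.Nat using (ℕ; _≤_; _<ᵇ_)
open import Data.Bool using (Bool; true; false; _∧_; _∨_; not; if_then_else_)
open import Data.Fin using (Fin; toℕ; _≟_)
open import Data.List using (List; []; _∷_; length; filter; map; concatMap; allFin; foldr)
open import Data.Vec using (Vec; []; _∷_; lookup)
open import Data.Product using (_×_; Σ; ∃; _,_)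
open import Relation.Binary.PropositionalEquality using (_≡_)
open import Relation.Nullary.Decidable using (⌊_⌋)
open import Relation.Unary using (Pred)
open import Data.Bool using (T)
open import Relation.Nullary using (Dec)

record Graph (n : ℕ) : Set where
  field
    adj    : Fin n → Fin n → Bool
    sym    : ∀ i j → adj i j ≡ adj j i
    irrefl : ∀ i → adj i i ≡ false
open Graph public

countB : {A : Set} → (A → Bool) → List A → ℕ
countB p xs = length (filter (λ x → T? (p x)) xs)
  where
  open import Data.Bool.Properties using () renaming (T? to T?)

pairs : (n : ℕ) → List (Fin n × Fin n)
pairs n = concatMap (λ i → map (λ j → (i , j)) (allFin n)) (allFin n)

edgeCount : {n : ℕ} → Graph n → ℕ
edgeCount {n} G = countB (λ { (i , j) → (toℕ i <ᵇ toℕ j) ∧ adj G i j }) (pairs n)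

allSubsets : (n : ℕ) → List (Vec Bool n)
allSubsets ℕ.zero = [] ∷ []
allSubsets (ℕ.suc n) = concatMap (λ s → (true ∷ s) ∷ (false ∷ s) ∷ []) (allSubsets n)

allB : {A : Set} → (A → Bool) → List A → Bool
allB p = foldr (λ x b → p x ∧ b) true

isClique : {n : ℕ} → Graph n → Vec Bool n → Bool
isClique {n} G S =
  allB (λ { (i , j) → not (lookup S i) ∨ not (lookup S j) ∨ ⌊ i ≟ j ⌋ ∨ adj G i j })
      (pairs n)

-- number of cliques (including the empty clique and single vertices)
cliqueCount : {n : ℕ} → Graph n → ℕ
cliqueCount {n} G = countB (isClique G) (allSubsets n)

record Subgraph {n : ℕ} (G : Graph n) : Set where
  field
    verts  : Fin n → Bool
    edges  : Fin n → Fin n → Bool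
    esym   : ∀ i j → edges i j ≡ edges j i
    sub    : ∀ i j → edges i j ≡ true →
               (adj G i j ≡ true) × (verts i ≡ true) × (verts j ≡ true)
open Subgraph public

degreeIn : {n : ℕ} {G : Graph n} → Subgraph G → Fin n → ℕ
degreeIn {n} H v = countB (edges H v) (allFin n)

Degenerate : {n : ℕ} → ℕ → Graph n → Set
Degenerate {n} d G =
  (H : Subgraph G) → (∃ λ v → verts H v ≡ true) →
  ∃ λ v → (verts H v ≡ true) × (degreeIn H v ≤ d)

{-# OPTIONS --safe #-}
module Submission where

-- Write m = d C 2 + f and let c(S) be the number of cliques inside a vertex set S. Deleting a
-- vertex v of degree k removes k edges and at most 2^k cliques, namely those containing v, which
-- lie in its closed neighbourhood. Since d·2^k + k ≤ d + k·2^d for k ≤ d (2^x lies below its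
-- chord), such a deletion preserves d·(c(S) + d) + f ≤ d·(|S| + 2^d) + f·2^d, and degeneracy
-- supplies a vertex of degree at most d as long as f ≥ d. When f < d we use instead the bound
-- c(S) + t + 1 ≤ |S| + 2^t + 2^r for graphs with t C 2 + r edges, r < t. It is proved the same
-- way, deleting a vertex of degree at most r, or else one of degree below t, which exists since
-- otherwise there would be at least (t + 1) C 2 edges; by convexity of 2^x both deletions
-- preserve the bound.

open import Defs hiding (sym)
open import Data.Nat using (ℕ; suc; _≥_) renaming (_^_ to _^ℕ_)
open import Data.Nat.Combinatorics using (_C_)

module Counting where

  open import Data.Bool using (Bool; true; false)
  open import Data.Bool.Properties using (∧-conicalˡ; ∧-conicalʳ; T?)
  open import Data.Fin using (Fin; zero; suc)
  open import Data.List using (List; []; _∷_; _++_; length; filter; map; concatMap; tabulate; allFin)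
  open import Data.List.Membership.Propositional using (_∈_)
  open import Data.List.Membership.Propositional.Properties using (∈-allFin; ∈-map⁺; ∈-concatMap⁺)
  open import Data.List.Properties using (map-tabulate; filter-++; length-++)
  import Data.List.Relation.Unary.Any as Any
  open import Data.List.Relation.Unary.Any using (here; there)
  open import Data.Nat using (ℕ; zero; suc; _+_; _≤_; _<_; z≤n; s≤s)
  open import Data.Nat.Properties
    using (+-0-commutativeMonoid; +-mono-≤; +-comm; +-assoc; +-identityʳ; ≤-refl; m≤m+n; m≤n+m; module ≤-Reasoning)
  open import Data.Nat.Tactic.RingSolver using (solve-∀)
  open import Data.Product using (∃; _,_; _×_)
  import Data.Product as Product
  open import Data.Sum using (_⊎_; inj₁; inj₂)
  open import Data.Vec using (Vec; _∷_)
  open import Function using (_∘_; id)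
  open import Relation.Binary.PropositionalEquality
    using (_≡_; _≢_; refl; sym; trans; subst; cong; cong₂; module ≡-Reasoning)

  open import Algebra.Properties.CommutativeMonoid.Sum +-0-commutativeMonoid public
    using (sum-syntax; sum-cong-≗; ∑-distrib-+)

  𝟙 : Bool → ℕ
  𝟙 true  = 1
  𝟙 false = 0

  𝟙≤1 : ∀ b → 𝟙 b ≤ 1
  𝟙≤1 true  = ≤-refl
  𝟙≤1 false = z≤n

  𝟙-pos : ∀ {b} → 0 < 𝟙 b → b ≡ true
  𝟙-pos {true} _ = refl

  ∑-zero : ∀ {n} {f : Fin n → ℕ} → (∀ i → f i ≡ 0) → ∑[ i < n ] f i ≡ 0
  ∑-zero {zero}  f≡0 = refl
  ∑-zero {suc n} f≡0 = cong₂ _+_ (f≡0 zero) (∑-zero (f≡0 ∘ suc))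

  ∑-except : ∀ {n} (v : Fin n) {f g : Fin n → ℕ} → (∀ i → i ≢ v → f i ≡ g i) → g v ≡ 0 →
             ∑[ i < n ] f i ≡ ∑[ i < n ] g i + f v
  ∑-except {suc n} zero {f} {g} f≡g gv≡0 = begin
    f zero + ∑[ i < n ] f (suc i)      ≡⟨ +-comm (f zero) _ ⟩
    ∑[ i < n ] f (suc i) + f zero      ≡⟨ cong (_+ f zero) (sum-cong-≗ λ i → f≡g (suc i) λ ()) ⟩
    ∑[ i < n ] g (suc i) + f zero      ≡⟨ cong (λ x → x + ∑[ i < n ] g (suc i) + f zero) gv≡0 ⟨
    g zero + ∑[ i < n ] g (suc i) + f zero ∎
    where open ≡-Reasoning
  ∑-except {suc n} (suc v) {f} {g} f≡g gv≡0 = begin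
    f zero + ∑[ i < n ] f (suc i)                ≡⟨ cong₂ _+_ (f≡g zero λ ()) IH ⟩
    g zero + (∑[ i < n ] g (suc i) + f (suc v))  ≡⟨ +-assoc (g zero) _ _ ⟨
    g zero + ∑[ i < n ] g (suc i) + f (suc v)    ∎
    where
    open ≡-Reasoning
    open import Data.Fin.Properties using (suc-injective)
    IH = ∑-except v (λ i i≢v → f≡g (suc i) (i≢v ∘ suc-injective)) gv≡0

  ∑-pos : ∀ {n} (f : Fin n → ℕ) → 0 < ∑[ i < n ] f i → ∃ λ i → 0 < f i
  ∑-pos {suc n} f 0<∑ with f zero in f₀≡
  ... | suc _ = zero , subst (0 <_) (sym f₀≡) (s≤s z≤n)
  ... | zero  = Product.map suc id (∑-pos (f ∘ suc) 0<∑)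

  module _ {A : Set} where

    countB-∷ : ∀ (p : A → Bool) x xs → countB p (x ∷ xs) ≡ 𝟙 (p x) + countB p xs
    countB-∷ p x xs with p x
    ... | true  = refl
    ... | false = refl

    countB-++ : ∀ (p : A → Bool) xs ys → countB p (xs ++ ys) ≡ countB p xs + countB p ys
    countB-++ p xs ys = trans (cong length (filter-++ (T? ∘ p) xs ys)) (length-++ (filter (T? ∘ p) xs))

    countB-cong : ∀ {p q : A → Bool} → (∀ x → p x ≡ q x) → ∀ xs → countB p xs ≡ countB q xs
    countB-cong         p≡q []       = refl
    countB-cong {p} {q} p≡q (x ∷ xs) = begin
      countB p (x ∷ xs)        ≡⟨ countB-∷ p x xs ⟩
      𝟙 (p x) + countB p xs    ≡⟨ cong₂ _+_ (cong 𝟙 (p≡q x)) (countB-cong p≡q xs) ⟩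
      𝟙 (q x) + countB q xs    ≡⟨ countB-∷ q x xs ⟨
      countB q (x ∷ xs)        ∎
      where open ≡-Reasoning

    countB-false : ∀ xs → countB (λ (_ : A) → false) xs ≡ 0
    countB-false []       = refl
    countB-false (_ ∷ xs) = countB-false xs

    countB-≤-+ : ∀ {p q r : A → Bool} → (∀ x → p x ≡ true → q x ≡ true ⊎ r x ≡ true) →
                 ∀ xs → countB p xs ≤ countB q xs + countB r xs
    countB-≤-+             p⇒q∨r []       = z≤n
    countB-≤-+ {p} {q} {r} p⇒q∨r (x ∷ xs) = begin
      countB p (x ∷ xs)                                    ≡⟨ countB-∷ p x xs ⟩
      𝟙 (p x) + countB p xs                                ≤⟨ +-mono-≤ (𝟙-≤-+ (p⇒q∨r x)) (countB-≤-+ p⇒q∨r xs) ⟩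
      (𝟙 (q x) + 𝟙 (r x)) + (countB q xs + countB r xs)  ≡⟨ interchange (𝟙 (q x)) _ _ _ ⟩
      (𝟙 (q x) + countB q xs) + (𝟙 (r x) + countB r xs)  ≡⟨ cong₂ _+_ (countB-∷ q x xs) (countB-∷ r x xs) ⟨
      countB q (x ∷ xs) + countB r (x ∷ xs)                ∎
      where
      open ≤-Reasoning
      𝟙-≤-+ : ∀ {b c e} → (b ≡ true → c ≡ true ⊎ e ≡ true) → 𝟙 b ≤ 𝟙 c + 𝟙 e
      𝟙-≤-+ {false} _ = z≤n
      𝟙-≤-+ {true} {c} {e} b⇒c∨e with b⇒c∨e refl
      ... | inj₁ refl = m≤m+n 1 (𝟙 e)
      ... | inj₂ refl = m≤n+m 1 (𝟙 c)
      interchange : ∀ a b c d → (a + b) + (c + d) ≡ (a + c) + (b + d)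
      interchange = solve-∀

    countB-mono : ∀ {p q : A → Bool} → (∀ x → p x ≡ true → q x ≡ true) → ∀ xs → countB p xs ≤ countB q xs
    countB-mono {p} {q} p⇒q xs =
      subst (countB p xs ≤_) (trans (cong (countB q xs +_) (countB-false xs)) (+-identityʳ _))
        (countB-≤-+ (λ x px → inj₁ (p⇒q x px)) xs)

    countB-tabulate : ∀ (p : A → Bool) {n} (f : Fin n → A) → countB p (tabulate f) ≡ ∑[ i < n ] 𝟙 (p (f i))
    countB-tabulate p {zero}  f = refl
    countB-tabulate p {suc n} f =
      trans (countB-∷ p (f zero) _) (cong (𝟙 (p (f zero)) +_) (countB-tabulate p (f ∘ suc)))

    countB-concatMap-tabulate : ∀ {B : Set} (p : A → Bool) (h : B → List A) {n} (f : Fin n → B) →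
                                countB p (concatMap h (tabulate f)) ≡ ∑[ i < n ] countB p (h (f i))
    countB-concatMap-tabulate p h {zero}  f = refl
    countB-concatMap-tabulate p h {suc n} f =
      trans (countB-++ p (h (f zero)) _) (cong (countB p (h (f zero)) +_) (countB-concatMap-tabulate p h (f ∘ suc)))

  countB-pairs : ∀ {n} (p : Fin n × Fin n → Bool) → countB p (pairs n) ≡ ∑[ i < n ] ∑[ j < n ] 𝟙 (p (i , j))
  countB-pairs {n} p = trans (countB-concatMap-tabulate p (λ i → map (i ,_) (allFin n)) id) (sum-cong-≗ row)
    where
    row : ∀ i → countB p (map (i ,_) (allFin n)) ≡ ∑[ j < n ] 𝟙 (p (i , j))
    row i = trans (cong (countB p) (map-tabulate id (i ,_))) (countB-tabulate p (i ,_))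

  countB-allSubsets-suc : ∀ {n} (p : Vec Bool (suc n) → Bool) →
    countB p (allSubsets (suc n)) ≡ countB (p ∘ (true ∷_)) (allSubsets n) + countB (p ∘ (false ∷_)) (allSubsets n)
  countB-allSubsets-suc {n} p = go (allSubsets n)
    where
    go : ∀ Ts → countB p (concatMap (λ T → (true ∷ T) ∷ (false ∷ T) ∷ []) Ts)
                  ≡ countB (p ∘ (true ∷_)) Ts + countB (p ∘ (false ∷_)) Ts
    go []       = refl
    go (T ∷ Ts) = begin
      countB p ((true ∷ T) ∷ (false ∷ T) ∷ rest)        ≡⟨ countB-∷ p _ _ ⟩
      a + countB p ((false ∷ T) ∷ rest)                 ≡⟨ cong (a +_) (countB-∷ p _ _) ⟩
      a + (b + countB p rest)                           ≡⟨ cong (λ c → a + (b + c)) (go Ts) ⟩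
      a + (b + (countB pᵗ Ts + countB pᶠ Ts))           ≡⟨ shuffle a b _ _ ⟩
      (a + countB pᵗ Ts) + (b + countB pᶠ Ts)           ≡⟨ cong₂ _+_ (countB-∷ pᵗ T Ts) (countB-∷ pᶠ T Ts) ⟨
      countB pᵗ (T ∷ Ts) + countB pᶠ (T ∷ Ts)           ∎
      where
      open ≡-Reasoning
      rest = concatMap (λ T → (true ∷ T) ∷ (false ∷ T) ∷ []) Ts
      pᵗ pᶠ : Vec Bool n → Bool
      pᵗ = p ∘ (true ∷_)
      pᶠ = p ∘ (false ∷_)
      a b : ℕ
      a = 𝟙 (pᵗ T)
      b = 𝟙 (pᶠ T)
      shuffle : ∀ a b c d → a + (b + (c + d)) ≡ (a + c) + (b + d)
      shuffle = solve-∀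

  allB-∈ : ∀ {A : Set} {p : A → Bool} {x xs} → allB p xs ≡ true → x ∈ xs → p x ≡ true
  allB-∈ {p = p} {xs = y ∷ _} all-p (here refl)  = ∧-conicalˡ (p y) _ all-p
  allB-∈ {p = p} {xs = y ∷ _} all-p (there x∈xs) = allB-∈ (∧-conicalʳ (p y) _ all-p) x∈xs

  ∈-pairs : ∀ {n} (i j : Fin n) → (i , j) ∈ pairs n
  ∈-pairs {n} i j =
    ∈-concatMap⁺ (λ k → map (k ,_) (allFin n)) (Any.map (λ { refl → ∈-map⁺ (i ,_) (∈-allFin j) }) (∈-allFin i))

module Arithmetic where

  open import Data.Nat using (zero; suc; _+_; _*_; _^_; _≤_; _<_; z≤n; s≤s)
  open import Data.Nat.Combinatorics using (_C_; nCk+nC[k+1]≡[n+1]C[k+1]; nC1≡n)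
  open import Data.Nat.Properties
  open import Data.Nat.Tactic.RingSolver using (solve-∀)
  open import Data.Empty using (⊥)
  open import Data.Product using (_,_)
  open import Relation.Binary.PropositionalEquality
    using (_≡_; refl; sym; trans; subst; cong; cong₂; module ≡-Reasoning)

  [1+n]C2≡n+nC2 : ∀ n → suc n C 2 ≡ n + n C 2
  [1+n]C2≡n+nC2 n = trans (sym (nCk+nC[k+1]≡[n+1]C[k+1] n 1)) (cong (_+ n C 2) (nC1≡n n))

  2*nC2+n≡n*n : ∀ n → 2 * (n C 2) + n ≡ n * n
  2*nC2+n≡n*n zero    = refl
  2*nC2+n≡n*n (suc n) = begin
    2 * (suc n C 2) + suc n          ≡⟨ cong (λ c → 2 * c + suc n) ([1+n]C2≡n+nC2 n) ⟩
    2 * (n + n C 2) + suc n          ≡⟨ regroup n (n C 2) ⟩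
    (2 * (n C 2) + n) + (1 + 2 * n)  ≡⟨ cong (_+ (1 + 2 * n)) (2*nC2+n≡n*n n) ⟩
    n * n + (1 + 2 * n)              ≡⟨ square n ⟩
    suc n * suc n                    ∎
    where
    open ≡-Reasoning
    regroup : ∀ n c → 2 * (n + c) + suc n ≡ (2 * c + n) + (1 + 2 * n)
    regroup = solve-∀
    square : ∀ n → n * n + (1 + 2 * n) ≡ suc n * suc n
    square = solve-∀

  2^n+2^n≡2^[1+n] : ∀ n → 2 ^ n + 2 ^ n ≡ 2 ^ suc n
  2^n+2^n≡2^[1+n] n = cong (2 ^ n +_) (sym (+-identityʳ (2 ^ n)))

  n<2^n : ∀ n → n < 2 ^ n
  n<2^n zero    = s≤s z≤n
  n<2^n (suc n) = begin-strict
    suc n          ≡⟨ +-comm 1 n ⟩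
    n + 1          <⟨ +-mono-<-≤ (n<2^n n) (m^n>0 2 n) ⟩
    2 ^ n + 2 ^ n  ≡⟨ 2^n+2^n≡2^[1+n] n ⟩
    2 ^ suc n      ∎
    where open ≤-Reasoning

  +≤1+* : ∀ {a b} → 1 ≤ a → 1 ≤ b → a + b ≤ 1 + a * b
  +≤1+* {suc a} {suc b} _ _ = subst (suc a + suc b ≤_) (expand a b) (m≤m+n (suc a + suc b) (a * b))
    where
    expand : ∀ a b → suc a + suc b + a * b ≡ 1 + suc a * suc b
    expand = solve-∀

  2^-convex : ∀ c x y → 2 ^ (c + x) + 2 ^ (c + y) ≤ 2 ^ c + 2 ^ (c + x + y)
  2^-convex c x y = begin
    2 ^ (c + x) + 2 ^ (c + y)  ≡⟨ cong₂ _+_ (^-distribˡ-+-* 2 c x) (^-distribˡ-+-* 2 c y) ⟩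
    P * X + P * Y              ≡⟨ *-distribˡ-+ P X Y ⟨
    P * (X + Y)                ≤⟨ *-monoʳ-≤ P (+≤1+* (m^n>0 2 x) (m^n>0 2 y)) ⟩
    P * (1 + X * Y)            ≡⟨ expand P X Y ⟩
    P + P * X * Y              ≡⟨ cong (P +_) 2^[c+x+y] ⟨
    2 ^ c + 2 ^ (c + x + y)    ∎
    where
    open ≤-Reasoning
    P = 2 ^ c
    X = 2 ^ x
    Y = 2 ^ y
    2^[c+x+y] : 2 ^ (c + x + y) ≡ P * X * Y
    2^[c+x+y] = trans (^-distribˡ-+-* 2 (c + x) y) (cong (_* Y) (^-distribˡ-+-* 2 c x))
    expand : ∀ P X Y → P * (1 + X * Y) ≡ P + P * X * Y
    expand = solve-∀

  2^-chord : ∀ {k d} → k ≤ d → d * 2 ^ k + k ≤ d + k * 2 ^ d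
  2^-chord {k} k≤d with t , refl ← m≤n⇒∃[o]m+o≡n k≤d = chord-+ t
    where
    2^k≤1+k*2^[k+t] : ∀ k t → 2 ^ k ≤ 1 + k * 2 ^ (k + t)
    2^k≤1+k*2^[k+t] zero    t = ≤-refl
    2^k≤1+k*2^[k+t] (suc k) t = begin
      2 ^ suc k                          ≤⟨ ^-monoʳ-≤ 2 (m≤m+n (suc k) t) ⟩
      2 ^ (suc k + t)                    ≤⟨ m≤n*m (2 ^ (suc k + t)) (suc k) ⟩
      suc k * 2 ^ (suc k + t)            ≤⟨ n≤1+n _ ⟩
      1 + suc k * 2 ^ (suc k + t)        ∎
      where open ≤-Reasoning
    chord-+ : ∀ t → (k + t) * 2 ^ k + k ≤ (k + t) + k * 2 ^ (k + t)
    chord-+ zero    rewrite +-identityʳ k = ≤-reflexive (+-comm (k * 2 ^ k) k)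
    chord-+ (suc t) = begin
      (k + suc t) * 2 ^ k + k                            ≡⟨ split-off k t (2 ^ k) ⟩
      ((k + t) * 2 ^ k + k) + 2 ^ k                      ≤⟨ +-mono-≤ (chord-+ t) (2^k≤1+k*2^[k+t] k t) ⟩
      ((k + t) + k * 2 ^ (k + t)) + (1 + k * 2 ^ (k + t)) ≡⟨ merge k t (2 ^ (k + t)) ⟩
      (k + suc t) + k * (2 * 2 ^ (k + t))                ≡⟨ cong (λ e → (k + suc t) + k * 2 ^ e) (+-suc k t) ⟨
      (k + suc t) + k * 2 ^ (k + suc t)                  ∎
      where
      open ≤-Reasoning
      split-off : ∀ k t P → (k + suc t) * P + k ≡ ((k + t) * P + k) + P
      split-off = solve-∀
      merge : ∀ k t Q → ((k + t) + k * Q) + (1 + k * Q) ≡ (k + suc t) + k * (2 * Q)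
      merge = solve-∀

  +-cancel-middle : ∀ {e k b y} → e + k ≡ b + (k + y) → e ≡ b + y
  +-cancel-middle {e} {k} {b} {y} eq = +-cancelʳ-≡ k e (b + y) (trans eq (regroup b k y))
    where
    regroup : ∀ b k y → b + (k + y) ≡ b + y + k
    regroup = solve-∀

  [1+m]C2-cancel : ∀ {e k y r} → e + k ≡ suc (k + y) C 2 + r → e ≡ (k + y) C 2 + (r + y)
  [1+m]C2-cancel {e} {k} {y} {r} eq =
    +-cancelʳ-≡ k e _ (trans eq (trans (cong (_+ r) ([1+n]C2≡n+nC2 (k + y))) (regroup k y ((k + y) C 2) r)))
    where
    regroup : ∀ k y c r → k + y + c + r ≡ c + (r + y) + k
    regroup = solve-∀

  [1+t]C2≰tC2+r : ∀ {t r} → r < t → suc t C 2 ≤ t C 2 + r → ⊥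
  [1+t]C2≰tC2+r {t} {r} r<t dense = <⇒≱ r<t (+-cancelˡ-≤ (t C 2) t r (begin
    t C 2 + t      ≡⟨ +-comm (t C 2) t ⟩
    t + t C 2      ≡⟨ [1+n]C2≡n+nC2 t ⟨
    suc t C 2      ≤⟨ dense ⟩
    t C 2 + r      ∎))
    where open ≤-Reasoning

  sparse-low-step : ∀ {c c′ s t k y} → c ≤ c′ + 2 ^ k → c′ + suc t ≤ s + 2 ^ t + 2 ^ y →
                    c + suc t ≤ suc s + 2 ^ t + 2 ^ (k + y)
  sparse-low-step {c} {c′} {s} {t} {k} {y} c≤ IH = begin
    c + suc t                          ≤⟨ +-monoˡ-≤ (suc t) c≤ ⟩
    c′ + 2 ^ k + suc t                 ≡⟨ swap c′ (2 ^ k) (suc t) ⟩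
    c′ + suc t + 2 ^ k                 ≤⟨ +-monoˡ-≤ (2 ^ k) IH ⟩
    s + 2 ^ t + 2 ^ y + 2 ^ k          ≡⟨ swap (s + 2 ^ t) (2 ^ y) (2 ^ k) ⟩
    s + 2 ^ t + 2 ^ k + 2 ^ y          ≡⟨ +-assoc (s + 2 ^ t) (2 ^ k) (2 ^ y) ⟩
    s + 2 ^ t + (2 ^ k + 2 ^ y)        ≤⟨ +-monoʳ-≤ (s + 2 ^ t) (2^-convex 0 k y) ⟩
    s + 2 ^ t + (1 + 2 ^ (k + y))      ≡⟨ regroup s (2 ^ t) (2 ^ (k + y)) ⟩
    suc s + 2 ^ t + 2 ^ (k + y)        ∎
    where
    open ≤-Reasoning
    swap : ∀ a b c → a + b + c ≡ a + c + b
    swap = solve-∀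
    regroup : ∀ s P Q → s + P + (1 + Q) ≡ suc s + P + Q
    regroup = solve-∀

  sparse-mid-step : ∀ {c c′ s r x y k} → r + x ≡ k → c ≤ c′ + 2 ^ k →
                    c′ + suc (k + y) ≤ s + 2 ^ (k + y) + 2 ^ (r + y) →
                    c + suc (suc (k + y)) ≤ suc s + 2 ^ suc (k + y) + 2 ^ r
  sparse-mid-step {c} {c′} {s} {r} {x} {y} refl c≤ IH = begin
    c + suc (suc (k + y))                          ≤⟨ +-monoˡ-≤ (suc (suc (k + y))) c≤ ⟩
    c′ + 2 ^ k + suc (suc (k + y))                 ≡⟨ regroup₁ c′ (2 ^ k) (k + y) ⟩
    c′ + suc (k + y) + (1 + 2 ^ k)                 ≤⟨ +-monoˡ-≤ (1 + 2 ^ k) IH ⟩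
    s + 2 ^ (k + y) + 2 ^ (r + y) + (1 + 2 ^ k)    ≡⟨ regroup₂ s (2 ^ (k + y)) (2 ^ (r + y)) (2 ^ k) ⟩
    suc s + 2 ^ (k + y) + (2 ^ k + 2 ^ (r + y))    ≤⟨ +-monoʳ-≤ (suc s + 2 ^ (k + y)) (2^-convex r x y) ⟩
    suc s + 2 ^ (k + y) + (2 ^ r + 2 ^ (k + y))    ≡⟨ regroup₃ s (2 ^ (k + y)) (2 ^ r) ⟩
    suc s + (2 ^ (k + y) + 2 ^ (k + y)) + 2 ^ r    ≡⟨ cong (λ P → suc s + P + 2 ^ r) (2^n+2^n≡2^[1+n] (k + y)) ⟩
    suc s + 2 ^ suc (k + y) + 2 ^ r                ∎
    where
    open ≤-Reasoning
    k = r + x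
    regroup₁ : ∀ c P m → c + P + suc (suc m) ≡ c + suc m + (1 + P)
    regroup₁ = solve-∀
    regroup₂ : ∀ s P Q R → s + P + Q + (1 + R) ≡ suc s + P + (R + Q)
    regroup₂ = solve-∀
    regroup₃ : ∀ s P R → suc s + P + (R + P) ≡ suc s + (P + P) + R
    regroup₃ = solve-∀

  degenerate-step : ∀ {d c c′ s k f X P} → c ≤ c′ + P → d * P + k ≤ d + k * X →
                    d * (c′ + d) + f ≤ d * (s + X) + f * X →
                    d * (c + d) + (k + f) ≤ d * (suc s + X) + (k + f) * X
  degenerate-step {d} {c} {c′} {s} {k} {f} {X} {P} c≤ chord-k IH = begin
    d * (c + d) + (k + f)                ≤⟨ +-monoˡ-≤ (k + f) (*-monoʳ-≤ d (+-monoˡ-≤ d c≤)) ⟩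
    d * (c′ + P + d) + (k + f)           ≡⟨ regroup₁ d c′ P k f ⟩
    (d * (c′ + d) + f) + (d * P + k)     ≤⟨ +-mono-≤ IH chord-k ⟩
    (d * (s + X) + f * X) + (d + k * X)  ≡⟨ regroup₂ d s X k f ⟩
    d * (suc s + X) + (k + f) * X        ∎
    where
    open ≤-Reasoning
    regroup₁ : ∀ d c P k f → d * (c + P + d) + (k + f) ≡ (d * (c + d) + f) + (d * P + k)
    regroup₁ = solve-∀
    regroup₂ : ∀ d s X k f → (d * (s + X) + f * X) + (d + k * X) ≡ d * (suc s + X) + (k + f) * X
    regroup₂ = solve-∀

  degenerate-base : ∀ {d c s f X P} → c + suc d ≤ s + X + P → d * P + f ≤ d + f * X →
                    d * (c + d) + f ≤ d * (s + X) + f * X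
  degenerate-base {d} {c} {s} {f} {X} {P} sparse chord-f = +-cancelʳ-≤ d _ _ (begin
    d * (c + d) + f + d         ≡⟨ regroup₁ d c f ⟩
    d * (c + suc d) + f         ≤⟨ +-monoˡ-≤ f (*-monoʳ-≤ d sparse) ⟩
    d * (s + X + P) + f         ≡⟨ regroup₂ d s X P f ⟩
    d * (s + X) + (d * P + f)   ≤⟨ +-monoʳ-≤ (d * (s + X)) chord-f ⟩
    d * (s + X) + (d + f * X)   ≡⟨ regroup₃ d s X f ⟩
    d * (s + X) + f * X + d     ∎)
    where
    open ≤-Reasoning
    regroup₁ : ∀ d c f → d * (c + d) + f + d ≡ d * (c + suc d) + f
    regroup₁ = solve-∀
    regroup₂ : ∀ d s X P f → d * (s + X + P) + f ≡ d * (s + X) + (d * P + f)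
    regroup₂ = solve-∀
    regroup₃ : ∀ d s X f → d * (s + X) + (d + f * X) ≡ d * (s + X) + f * X + d
    regroup₃ = solve-∀

module VertexSets where

  open Counting
  open Arithmetic using (2^n+2^n≡2^[1+n])
  open import Data.Bool using (Bool; true; false; _∧_; _∨_; not)
  open import Data.Bool.Properties using (∧-zeroʳ; ∧-conicalˡ; ∧-conicalʳ)
  open import Data.Fin using (Fin; zero; suc; _≟_)
  open import Data.Nat using (ℕ; zero; suc; _+_; _^_; _<_)
  open import Data.Nat.Properties using (+-comm; +-identityʳ)
  open import Data.Product using (∃; _,_; _×_)
  import Data.Product as Product
  open import Data.Vec using (Vec; []; _∷_; lookup)
  open import Function using (_∘_)
  open import Relation.Binary.PropositionalEquality
    using (_≡_; _≢_; refl; sym; trans; cong; cong₂; module ≡-Reasoning)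
  open import Relation.Nullary using (does; contradiction)
  open import Relation.Nullary.Decidable using (dec-true; dec-false)

  -- `does` rather than `⌊_⌋`, so that `(S - suc v) ∘ suc` reduces to `(S ∘ suc) - v`.
  _-_ : ∀ {n} → (Fin n → Bool) → Fin n → Fin n → Bool
  (S - v) i = not (does (i ≟ v)) ∧ S i

  ∣_∣ : ∀ {n} → (Fin n → Bool) → ℕ
  ∣_∣ {n} S = ∑[ i < n ] 𝟙 (S i)

  module _ {n} (S : Fin n → Bool) where

    remove-self : ∀ v → (S - v) v ≡ false
    remove-self v = cong (λ b → not b ∧ S v) (dec-true (v ≟ v) refl)

    remove-other : ∀ {v i} → i ≢ v → (S - v) i ≡ S i
    remove-other {v} {i} i≢v = cong (λ b → not b ∧ S i) (dec-false (i ≟ v) i≢v)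

    ∈-remove⁻ : ∀ {v u} → (S - v) u ≡ true → u ≢ v × S u ≡ true
    ∈-remove⁻ {v} {u} u∈S-v = u≢v , ∧-conicalʳ _ _ u∈S-v
      where
      u≢v : u ≢ v
      u≢v refl = contradiction (trans (sym (remove-self u)) u∈S-v) λ ()

    ∈-remove⁺ : ∀ {v u} → u ≢ v → S u ≡ true → (S - v) u ≡ true
    ∈-remove⁺ u≢v u∈S = trans (remove-other u≢v) u∈S

    ∣S∣≡1+∣S-v∣ : ∀ {v} → S v ≡ true → ∣ S ∣ ≡ suc ∣ S - v ∣
    ∣S∣≡1+∣S-v∣ {v} v∈S = begin
      ∣ S ∣                  ≡⟨ ∑-except v (λ i i≢v → cong 𝟙 (sym (remove-other i≢v))) (cong 𝟙 (remove-self v)) ⟩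
      ∣ S - v ∣ + 𝟙 (S v)    ≡⟨ cong (λ b → ∣ S - v ∣ + 𝟙 b) v∈S ⟩
      ∣ S - v ∣ + 1          ≡⟨ +-comm ∣ S - v ∣ 1 ⟩
      suc ∣ S - v ∣          ∎
      where open ≡-Reasoning

    ∣S∣-witness : 0 < ∣ S ∣ → ∃ λ v → S v ≡ true
    ∣S∣-witness 0<∣S∣ = Product.map₂ 𝟙-pos (∑-pos (𝟙 ∘ S) 0<∣S∣)

  _⊆ᵇ_ : ∀ {n} → Vec Bool n → (Fin n → Bool) → Bool
  []      ⊆ᵇ S = true
  (b ∷ T) ⊆ᵇ S = (not b ∨ S zero) ∧ (T ⊆ᵇ (S ∘ suc))

  ⊆ᵇ-sound : ∀ {n} (T : Vec Bool n) S → T ⊆ᵇ S ≡ true → ∀ i → lookup T i ≡ true → S i ≡ true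
  ⊆ᵇ-sound (true ∷ T) S T⊆S zero    refl = ∧-conicalˡ (S zero) _ T⊆S
  ⊆ᵇ-sound (b    ∷ T) S T⊆S (suc i) i∈T  = ⊆ᵇ-sound T (S ∘ suc) (∧-conicalʳ (not b ∨ S zero) _ T⊆S) i i∈T

  ⊆ᵇ-complete : ∀ {n} (T : Vec Bool n) S → (∀ i → lookup T i ≡ true → S i ≡ true) → T ⊆ᵇ S ≡ true
  ⊆ᵇ-complete []          S T⊆S = refl
  ⊆ᵇ-complete (false ∷ T) S T⊆S = ⊆ᵇ-complete T (S ∘ suc) (T⊆S ∘ suc)
  ⊆ᵇ-complete (true  ∷ T) S T⊆S rewrite T⊆S zero refl = ⊆ᵇ-complete T (S ∘ suc) (T⊆S ∘ suc)

  #⊆≡2^∣S∣ : ∀ {n} (S : Fin n → Bool) → countB (_⊆ᵇ S) (allSubsets n) ≡ 2 ^ ∣ S ∣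
  #⊆≡2^∣S∣ {zero}  S = refl
  #⊆≡2^∣S∣ {suc n} S = trans (countB-allSubsets-suc (_⊆ᵇ S)) (by-first-vertex (S zero))
    where
    IH : countB (_⊆ᵇ (S ∘ suc)) (allSubsets n) ≡ 2 ^ ∣ S ∘ suc ∣
    IH = #⊆≡2^∣S∣ (S ∘ suc)
    by-first-vertex : ∀ b → countB (λ T → b ∧ T ⊆ᵇ (S ∘ suc)) (allSubsets n)
                              + countB (_⊆ᵇ (S ∘ suc)) (allSubsets n)
                            ≡ 2 ^ (𝟙 b + ∣ S ∘ suc ∣)
    by-first-vertex true  = trans (cong₂ _+_ IH IH) (2^n+2^n≡2^[1+n] ∣ S ∘ suc ∣)
    by-first-vertex false = trans (cong (_+ countB (_⊆ᵇ (S ∘ suc)) (allSubsets n)) (countB-false (allSubsets n))) IH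

  #∋v⊆≡2^∣S-v∣ : ∀ {n} (S : Fin n → Bool) v → S v ≡ true →
                 countB (λ T → lookup T v ∧ T ⊆ᵇ S) (allSubsets n) ≡ 2 ^ ∣ S - v ∣
  #∋v⊆≡2^∣S-v∣ {suc n} S zero v∈S = begin
    countB (λ T → lookup T zero ∧ T ⊆ᵇ S) (allSubsets (suc n))
      ≡⟨ countB-allSubsets-suc (λ T → lookup T zero ∧ T ⊆ᵇ S) ⟩
    countB (λ T → S zero ∧ T ⊆ᵇ (S ∘ suc)) Ts + countB (λ _ → false) Ts
      ≡⟨ cong₂ _+_ (countB-cong (λ T → cong (_∧ T ⊆ᵇ (S ∘ suc)) v∈S) Ts) (countB-false Ts) ⟩
    countB (_⊆ᵇ (S ∘ suc)) Ts + 0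
      ≡⟨ +-identityʳ _ ⟩
    countB (_⊆ᵇ (S ∘ suc)) Ts
      ≡⟨ #⊆≡2^∣S∣ (S ∘ suc) ⟩
    2 ^ ∣ S ∘ suc ∣
      ∎
    where
    open ≡-Reasoning
    Ts = allSubsets n
  #∋v⊆≡2^∣S-v∣ {suc n} S (suc v) v∈S =
    trans (countB-allSubsets-suc (λ T → lookup T (suc v) ∧ T ⊆ᵇ S)) (by-first-vertex (S zero))
    where
    Ts = allSubsets n
    IH : countB (λ T → lookup T v ∧ T ⊆ᵇ (S ∘ suc)) Ts ≡ 2 ^ ∣ (S ∘ suc) - v ∣
    IH = #∋v⊆≡2^∣S-v∣ (S ∘ suc) v v∈S
    by-first-vertex : ∀ b → countB (λ T → lookup T v ∧ (b ∧ T ⊆ᵇ (S ∘ suc))) Ts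
                              + countB (λ T → lookup T v ∧ T ⊆ᵇ (S ∘ suc)) Ts
                            ≡ 2 ^ (𝟙 b + ∣ (S ∘ suc) - v ∣)
    by-first-vertex true  = trans (cong₂ _+_ IH IH) (2^n+2^n≡2^[1+n] ∣ (S ∘ suc) - v ∣)
    by-first-vertex false = trans (cong (_+ countB (λ T → lookup T v ∧ T ⊆ᵇ (S ∘ suc)) Ts) none) IH
      where
      none : countB (λ T → lookup T v ∧ false) Ts ≡ 0
      none = trans (countB-cong (λ T → ∧-zeroʳ (lookup T v)) Ts) (countB-false Ts)

  ∣all∣≡n : ∀ n → ∣ (λ (_ : Fin n) → true) ∣ ≡ n
  ∣all∣≡n zero    = refl
  ∣all∣≡n (suc n) = cong suc (∣all∣≡n n)

module InducedSubgraph {n : ℕ} (G : Graph n) where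

  open Counting
  open VertexSets
  open Arithmetic using ([1+n]C2≡n+nC2)
  open import Data.Bool using (Bool; true; false; _∧_; _∨_; not)
  open import Data.Bool.Properties using (∧-comm; ∧-identityʳ; ∧-conicalˡ; ∧-conicalʳ)
  open import Data.Fin using (Fin; zero; suc; toℕ; _≟_)
  open import Data.Nat using (ℕ; zero; suc; _+_; _^_; _≤_; _<_; _<ᵇ_; z≤n; s≤s)
  open import Data.Nat.Combinatorics using (_C_)
  open import Data.Nat.Properties
    using (+-comm; +-assoc; +-mono-≤; +-monoʳ-≤; ≤-trans; ≤-reflexive; ≤-pred; module ≤-Reasoning)
  open import Data.Product using (∃; _,_; _×_; proj₁; proj₂)
  import Data.Product as Product
  open import Data.Sum using (_⊎_; inj₁; inj₂)
  open import Data.Vec using (lookup)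
  open import Function using (_∘_; id)
  open import Relation.Binary.PropositionalEquality
    using (_≡_; _≢_; refl; sym; trans; subst; cong; cong₂; ≢-sym; module ≡-Reasoning)
  open import Relation.Nullary using (does; yes; no; contradiction)
  open import Relation.Nullary.Decidable using (⌊_⌋; dec-true)

  adjIn : (Fin n → Bool) → Fin n → Fin n → Bool
  adjIn S i j = S i ∧ S j ∧ adj G i j

  degIn : (Fin n → Bool) → Fin n → ℕ
  degIn S v = ∑[ j < n ] 𝟙 (adjIn S v j)

  edgesIn : (Fin n → Bool) → ℕ
  edgesIn S = ∑[ i < n ] ∑[ j < n ] 𝟙 (adjIn S i j ∧ (toℕ i <ᵇ toℕ j))

  cliquesIn : (Fin n → Bool) → ℕ
  cliquesIn S = countB (λ T → isClique G T ∧ T ⊆ᵇ S) (allSubsets n)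

  private
    ∧-true : ∀ {a b} → a ≡ true → b ≡ true → a ∧ b ≡ true
    ∧-true refl refl = refl

  adjIn-sym : ∀ S i j → adjIn S i j ≡ adjIn S j i
  adjIn-sym S i j rewrite Graph.sym G i j with S i | S j
  ... | true  | true  = refl
  ... | true  | false = refl
  ... | false | true  = refl
  ... | false | false = refl

  adjIn-irrefl : ∀ S v → adjIn S v v ≡ false
  adjIn-irrefl S v rewrite irrefl G v with S v
  ... | true  = refl
  ... | false = refl

  adjIn⇒≢ : ∀ {S i j} → adjIn S i j ≡ true → i ≢ j
  adjIn⇒≢ {S} {i} ij∈S refl = contradiction (trans (sym (adjIn-irrefl S i)) ij∈S) λ ()

  module _ (S : Fin n → Bool) where

    adjIn-removedˡ : ∀ v j → adjIn (S - v) v j ≡ false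
    adjIn-removedˡ v j rewrite remove-self S v = refl

    adjIn-removedʳ : ∀ v i → adjIn (S - v) i v ≡ false
    adjIn-removedʳ v i = trans (adjIn-sym (S - v) i v) (adjIn-removedˡ v i)

    adjIn-remove : ∀ {v i j} → i ≢ v → j ≢ v → adjIn (S - v) i j ≡ adjIn S i j
    adjIn-remove i≢v j≢v rewrite remove-other S i≢v | remove-other S j≢v = refl

  degIn-remove : ∀ S {u w} → u ≢ w → degIn S u ≡ degIn (S - w) u + 𝟙 (adjIn S u w)
  degIn-remove S {u} {w} u≢w =
    ∑-except w (λ j j≢w → cong 𝟙 (sym (adjIn-remove S u≢w j≢w))) (cong 𝟙 (adjIn-removedʳ S w u))

  private
    𝟙<ᵇ+𝟙>ᵇ≡1 : ∀ {m} {i j : Fin m} → i ≢ j → 𝟙 (toℕ i <ᵇ toℕ j) + 𝟙 (toℕ j <ᵇ toℕ i) ≡ 1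
    𝟙<ᵇ+𝟙>ᵇ≡1 {i = zero}  {zero}  i≢j = contradiction refl i≢j
    𝟙<ᵇ+𝟙>ᵇ≡1 {i = zero}  {suc j} i≢j = refl
    𝟙<ᵇ+𝟙>ᵇ≡1 {i = suc i} {zero}  i≢j = refl
    𝟙<ᵇ+𝟙>ᵇ≡1 {i = suc i} {suc j} i≢j = 𝟙<ᵇ+𝟙>ᵇ≡1 (i≢j ∘ cong suc)

  edgesIn-remove : ∀ S v → edgesIn S ≡ edgesIn (S - v) + degIn S v
  edgesIn-remove S v = begin
    ∑[ i < n ] row S i
      ≡⟨ ∑-except v (λ i → row-remove) row-v-removed ⟩
    ∑[ i < n ] (row (S - v) i + E S i v) + row S v
      ≡⟨ cong (_+ row S v) (∑-distrib-+ (row (S - v)) (λ i → E S i v)) ⟩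
    edgesIn (S - v) + ∑[ i < n ] E S i v + ∑[ j < n ] E S v j
      ≡⟨ +-assoc (edgesIn (S - v)) _ _ ⟩
    edgesIn (S - v) + (∑[ j < n ] E S j v + ∑[ j < n ] E S v j)
      ≡⟨ cong (edgesIn (S - v) +_) (trans (sym (∑-distrib-+ (λ j → E S j v) (E S v))) (sum-cong-≗ merge)) ⟩
    edgesIn (S - v) + degIn S v
      ∎
    where
    open ≡-Reasoning
    E : (Fin n → Bool) → Fin n → Fin n → ℕ
    E S i j = 𝟙 (adjIn S i j ∧ (toℕ i <ᵇ toℕ j))
    row : (Fin n → Bool) → Fin n → ℕ
    row S i = ∑[ j < n ] E S i j
    E≡0 : ∀ S i j → adjIn S i j ≡ false → E S i j ≡ 0
    E≡0 S i j ij∉S = cong (λ b → 𝟙 (b ∧ (toℕ i <ᵇ toℕ j))) ij∉S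
    row-remove : ∀ {i} → i ≢ v → row S i ≡ row (S - v) i + E S i v
    row-remove {i} i≢v =
      ∑-except v (λ j j≢v → cong (λ b → 𝟙 (b ∧ (toℕ i <ᵇ toℕ j))) (sym (adjIn-remove S i≢v j≢v)))
                 (E≡0 (S - v) i v (adjIn-removedʳ S v i))
    row-v-removed : row (S - v) v + E S v v ≡ 0
    row-v-removed = cong₂ _+_ (∑-zero λ j → E≡0 (S - v) v j (adjIn-removedˡ S v j)) (E≡0 S v v (adjIn-irrefl S v))
    merge : ∀ j → E S j v + E S v j ≡ 𝟙 (adjIn S v j)
    merge j rewrite adjIn-sym S j v with adjIn S v j in vj∈S
    ... | false = refl
    ... | true  = trans (+-comm (𝟙 (toℕ j <ᵇ toℕ v)) _) (𝟙<ᵇ+𝟙>ᵇ≡1 (adjIn⇒≢ {S} {v} {j} vj∈S))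

  edgesIn-witness : ∀ S → 0 < edgesIn S → ∃ λ v → S v ≡ true
  edgesIn-witness S 0<e =
    let i , 0<row = ∑-pos (λ i → ∑[ j < n ] 𝟙 (adjIn S i j ∧ (toℕ i <ᵇ toℕ j))) 0<e
        j , 0<𝟙   = ∑-pos (λ j → 𝟙 (adjIn S i j ∧ (toℕ i <ᵇ toℕ j))) 0<row
    in  i , ∧-conicalˡ (S i) _ (∧-conicalˡ (adjIn S i j) _ (𝟙-pos 0<𝟙))

  edgesIn-minDegree : ∀ k S {w} → S w ≡ true → (∀ u → S u ≡ true → k ≤ degIn S u) → suc k C 2 ≤ edgesIn S
  edgesIn-minDegree zero    S w∈S k≤deg = z≤n
  edgesIn-minDegree (suc k) S {w} w∈S k≤deg = begin
    suc (suc k) C 2              ≡⟨ [1+n]C2≡n+nC2 (suc k) ⟩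
    suc k + suc k C 2            ≤⟨ +-mono-≤ (k≤deg w w∈S) (edgesIn-minDegree k (S - w) j∈S-w k≤deg′) ⟩
    degIn S w + edgesIn (S - w)  ≡⟨ +-comm (degIn S w) _ ⟩
    edgesIn (S - w) + degIn S w  ≡⟨ edgesIn-remove S w ⟨
    edgesIn S                    ∎
    where
    open ≤-Reasoning
    neighbour : ∃ λ j → adjIn S w j ≡ true
    neighbour = Product.map₂ 𝟙-pos (∑-pos (𝟙 ∘ adjIn S w) (≤-trans (s≤s z≤n) (k≤deg w w∈S)))
    j = proj₁ neighbour
    j∈S-w : (S - w) j ≡ true
    j∈S-w = ∈-remove⁺ S (≢-sym (adjIn⇒≢ {S} {w} (proj₂ neighbour)))
                        (∧-conicalˡ (S j) _ (∧-conicalʳ (S w) _ (proj₂ neighbour)))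
    k≤deg′ : ∀ u → (S - w) u ≡ true → k ≤ degIn (S - w) u
    k≤deg′ u u∈S-w with u≢w , u∈S ← ∈-remove⁻ S u∈S-w = ≤-pred (begin
      suc k                                       ≤⟨ k≤deg u u∈S ⟩
      degIn S u                                   ≡⟨ degIn-remove S u≢w ⟩
      degIn (S - w) u + 𝟙 (adjIn S u w)           ≤⟨ +-monoʳ-≤ (degIn (S - w) u) (𝟙≤1 _) ⟩
      degIn (S - w) u + 1                         ≡⟨ +-comm (degIn (S - w) u) 1 ⟩
      suc (degIn (S - w) u)                       ∎)

  clique-adj : ∀ {T i j} → isClique G T ≡ true → lookup T i ≡ true → lookup T j ≡ true → i ≢ j →
               adj G i j ≡ true
  clique-adj {T} {i} {j} T-clique i∈T j∈T i≢j = trans (sym simplify) (allB-∈ T-clique (∈-pairs i j))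
    where
    simplify : (not (lookup T i) ∨ not (lookup T j) ∨ ⌊ i ≟ j ⌋ ∨ adj G i j) ≡ adj G i j
    simplify rewrite i∈T | j∈T with i ≟ j
    ... | yes i≡j = contradiction i≡j i≢j
    ... | no  _   = refl

  cliquesIn≤2^∣S∣ : ∀ S → cliquesIn S ≤ 2 ^ ∣ S ∣
  cliquesIn≤2^∣S∣ S =
    ≤-trans (countB-mono (λ T → ∧-conicalʳ (isClique G T) _) (allSubsets n)) (≤-reflexive (#⊆≡2^∣S∣ S))

  cliquesIn-remove : ∀ S {v} → S v ≡ true → cliquesIn S ≤ cliquesIn (S - v) + 2 ^ degIn S v
  cliquesIn-remove S {v} v∈S = begin
    cliquesIn S
      ≤⟨ countB-≤-+ clique-with-or-without-v (allSubsets n) ⟩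
    cliquesIn (S - v) + countB (λ T → lookup T v ∧ T ⊆ᵇ N) (allSubsets n)
      ≡⟨ cong (cliquesIn (S - v) +_) (#∋v⊆≡2^∣S-v∣ N v v∈N) ⟩
    cliquesIn (S - v) + 2 ^ ∣ N - v ∣
      ≡⟨ cong (λ k → cliquesIn (S - v) + 2 ^ k) (sum-cong-≗ (cong 𝟙 ∘ N-v≡N[v])) ⟩
    cliquesIn (S - v) + 2 ^ degIn S v
      ∎
    where
    open ≤-Reasoning
    N : Fin n → Bool
    N i = does (i ≟ v) ∨ adjIn S v i
    v∈N : N v ≡ true
    v∈N = cong (_∨ adjIn S v v) (dec-true (v ≟ v) refl)
    N-v≡N[v] : ∀ i → (N - v) i ≡ adjIn S v i
    N-v≡N[v] i with i ≟ v
    ... | yes refl = sym (adjIn-irrefl S i)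
    ... | no  _    = refl
    clique-with-or-without-v : ∀ T → isClique G T ∧ T ⊆ᵇ S ≡ true →
                               isClique G T ∧ T ⊆ᵇ (S - v) ≡ true ⊎ lookup T v ∧ T ⊆ᵇ N ≡ true
    clique-with-or-without-v T T∈cl[S] with lookup T v in v∈T?
    ... | false =
      inj₁ (∧-true T-clique (⊆ᵇ-complete T (S - v) λ i i∈T → ∈-remove⁺ S (i≢v i∈T) (⊆ᵇ-sound T S T⊆S i i∈T)))
      where
      T-clique = ∧-conicalˡ (isClique G T) _ T∈cl[S]
      T⊆S = ∧-conicalʳ (isClique G T) _ T∈cl[S]
      i≢v : ∀ {i} → lookup T i ≡ true → i ≢ v
      i≢v i∈T refl = contradiction (trans (sym v∈T?) i∈T) λ ()
    ... | true = inj₂ (⊆ᵇ-complete T N in-N)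
      where
      T-clique = ∧-conicalˡ (isClique G T) _ T∈cl[S]
      T⊆S = ∧-conicalʳ (isClique G T) _ T∈cl[S]
      in-N : ∀ i → lookup T i ≡ true → N i ≡ true
      in-N i i∈T with i ≟ v
      ... | yes _   = refl
      ... | no  i≢v =
        ∧-true v∈S (∧-true (⊆ᵇ-sound T S T⊆S i i∈T) (clique-adj {T} T-clique v∈T? i∈T (≢-sym i≢v)))

  cliquesIn-all : cliquesIn (λ _ → true) ≡ cliqueCount G
  cliquesIn-all =
    countB-cong (λ T → trans (cong (isClique G T ∧_) (⊆ᵇ-complete T _ λ _ _ → refl)) (∧-identityʳ _)) (allSubsets n)

  edgesIn-all : edgesIn (λ _ → true) ≡ edgeCount G
  edgesIn-all = trans (sum-cong-≗ λ i → sum-cong-≗ λ j → cong 𝟙 (∧-comm (adj G i j) _)) (sym (countB-pairs {n} _))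

  induced : (Fin n → Bool) → Subgraph G
  induced S = record
    { verts = S
    ; edges = adjIn S
    ; esym  = adjIn-sym S
    ; sub   = λ i j ij∈S → let j-adj = ∧-conicalʳ (S i) _ ij∈S in
                ∧-conicalʳ (S j) _ j-adj , ∧-conicalˡ (S i) _ ij∈S , ∧-conicalˡ (S j) _ j-adj
    }

  low-degree-vertex : ∀ {d} → Degenerate d G → ∀ S {w} → S w ≡ true → ∃ λ v → S v ≡ true × degIn S v ≤ d
  low-degree-vertex {d} G-degenerate S w∈S =
    let v , v∈S , deg≤d = G-degenerate (induced S) (_ , w∈S)
    in  v , v∈S , subst (_≤ d) (countB-tabulate (adjIn S v) id) deg≤d

module CliqueBounds {n : ℕ} (G : Graph n) where

  open VertexSets
  open Arithmetic
  open InducedSubgraph G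
  import Data.Bool.Properties as Bool
  open import Data.Bool using (Bool; true)
  open import Data.Empty using (⊥-elim)
  open import Data.Fin using (Fin)
  open import Data.Fin.Properties using (any?)
  open import Data.Nat using (ℕ; zero; suc; _+_; _*_; _^_; _≤_; _<_; _≤?_; _<?_; z≤n; s≤s)
  open import Data.Nat.Properties
  open import Data.Product using (∃; _,_; proj₂)
  open import Relation.Binary.PropositionalEquality using (_≡_; refl; sym; trans; subst)
  open import Relation.Nullary using (yes; no; contradiction)
  open import Relation.Nullary.Decidable using (_×-dec_)

  -- Equality holds for K_t plus a vertex joined to r of its vertices, plus isolated vertices.
  SparseBound : ℕ → (Fin n → Bool) → Set
  SparseBound s S = ∀ t r → r < t → edgesIn S ≡ t C 2 + r → cliquesIn S + suc t ≤ s + 2 ^ t + 2 ^ r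

  module _ {s : ℕ} {S : Fin n → Bool} {v : Fin n} (v∈S : S v ≡ true) (IH : SparseBound s (S - v)) {t r : ℕ} where

    sparse-remove-low : degIn S v ≤ r → r < t → edgesIn S ≡ t C 2 + r →
                        cliquesIn S + suc t ≤ suc s + 2 ^ t + 2 ^ r
    sparse-remove-low k≤r r<t e≡ with y , refl ← m≤n⇒∃[o]m+o≡n k≤r =
      sparse-low-step {c′ = cliquesIn (S - v)} {s} {t} {degIn S v} {y} (cliquesIn-remove S v∈S)
        (IH t y (≤-<-trans (m≤n+m y _) r<t) (+-cancel-middle {b = t C 2} (trans (sym (edgesIn-remove S v)) e≡)))

    sparse-remove-mid : r < degIn S v → degIn S v < t → edgesIn S ≡ t C 2 + r →
                        cliquesIn S + suc t ≤ suc s + 2 ^ t + 2 ^ r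
    sparse-remove-mid r<k k<t e≡
      with y , refl ← m≤n⇒∃[o]m+o≡n k<t | x , r+x≡k ← m≤n⇒∃[o]m+o≡n (<⇒≤ r<k) =
      sparse-mid-step {c′ = cliquesIn (S - v)} {s} {r} {x} {y} r+x≡k (cliquesIn-remove S v∈S)
        (IH (degIn S v + y) (r + y) (+-monoˡ-< y r<k)
            ([1+m]C2-cancel {k = degIn S v} {y} (trans (sym (edgesIn-remove S v)) e≡)))

  sparse-step : ∀ {s} S → (∃ λ w → S w ≡ true) → (∀ {v} → S v ≡ true → SparseBound s (S - v)) →
                SparseBound (suc s) S
  sparse-step S (w , w∈S) IH t r r<t e≡ with any? (λ v → S v Bool.≟ true ×-dec degIn S v ≤? r)
  ... | yes (v , v∈S , k≤r) = sparse-remove-low v∈S (IH v∈S) k≤r r<t e≡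
  ... | no ∄low with any? (λ v → S v Bool.≟ true ×-dec degIn S v <? t)
  ...   | yes (v , v∈S , k<t) = sparse-remove-mid v∈S (IH v∈S) (≰⇒> λ k≤r → ∄low (v , v∈S , k≤r)) k<t e≡
  ...   | no ∄mid = ⊥-elim ([1+t]C2≰tC2+r r<t (begin
          suc t C 2   ≤⟨ edgesIn-minDegree t S w∈S (λ u u∈S → ≮⇒≥ λ k<t → ∄mid (u , u∈S , k<t)) ⟩
          edgesIn S   ≡⟨ e≡ ⟩
          t C 2 + r   ∎))
    where open ≤-Reasoning

  sparse-clique-bound : ∀ s S → ∣ S ∣ ≡ s → SparseBound s S
  sparse-clique-bound zero S ∣S∣≡0 t r r<t _ = begin
    cliquesIn S + suc t  ≤⟨ +-monoˡ-≤ (suc t) (subst (λ k → cliquesIn S ≤ 2 ^ k) ∣S∣≡0 (cliquesIn≤2^∣S∣ S)) ⟩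
    1 + suc t            ≡⟨ +-comm 1 (suc t) ⟩
    suc t + 1            ≤⟨ +-mono-≤ (n<2^n t) (m^n>0 2 r) ⟩
    2 ^ t + 2 ^ r        ∎
    where open ≤-Reasoning
  sparse-clique-bound (suc s) S ∣S∣≡1+s = sparse-step S (∣S∣-witness S (subst (0 <_) (sym ∣S∣≡1+s) (s≤s z≤n))) IH
    where
    IH : ∀ {v} → S v ≡ true → SparseBound s (S - v)
    IH v∈S = sparse-clique-bound s (S - _) (suc-injective (trans (sym (∣S∣≡1+∣S-v∣ S v∈S)) ∣S∣≡1+s))

  module _ {d : ℕ} (G-degenerate : Degenerate d G) (d≥1 : 1 ≤ d) where

    -- The bound of the theorem for m = d C 2 + f, rearranged so that no subtraction occurs.
    DegenerateBound : ℕ → (Fin n → Bool) → Set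
    DegenerateBound s S = ∀ f → edgesIn S ≡ d C 2 + f → d * (cliquesIn S + d) + f ≤ d * (s + 2 ^ d) + f * 2 ^ d

    degenerate-remove : ∀ {s S v f} → S v ≡ true → degIn S v ≤ d → d ≤ f → DegenerateBound s (S - v) →
                      edgesIn S ≡ d C 2 + f → d * (cliquesIn S + d) + f ≤ d * (suc s + 2 ^ d) + f * 2 ^ d
    degenerate-remove {s} {S} {v} v∈S k≤d d≤f IH e≡ with f′ , refl ← m≤n⇒∃[o]m+o≡n (≤-trans k≤d d≤f) =
      degenerate-step {d} {c′ = cliquesIn (S - v)} {s} {f = f′} (cliquesIn-remove S v∈S) (2^-chord k≤d)
        (IH f′ (+-cancel-middle {b = d C 2} (trans (sym (edgesIn-remove S v)) e≡)))

    degenerate-clique-bound : ∀ s S → ∣ S ∣ ≡ s → DegenerateBound s S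
    degenerate-clique-bound s S ∣S∣≡s f e≡ with f <? d
    ... | yes f<d = degenerate-base (sparse-clique-bound s S ∣S∣≡s d f f<d e≡) (2^-chord (<⇒≤ f<d))
    ... | no  f≮d with low-degree-vertex G-degenerate S (proj₂ (edgesIn-witness S 0<e))
      where
      0<e : 0 < edgesIn S
      0<e = subst (0 <_) (sym e≡) (≤-trans d≥1 (≤-trans (≮⇒≥ f≮d) (m≤n+m f (d C 2))))
    degenerate-clique-bound zero    S ∣S∣≡0   f e≡ | no _   | v , v∈S , _   =
      contradiction (trans (sym ∣S∣≡0) (∣S∣≡1+∣S-v∣ S v∈S)) λ ()
    degenerate-clique-bound (suc s) S ∣S∣≡1+s f e≡ | no f≮d | v , v∈S , k≤d =
      degenerate-remove v∈S k≤d (≮⇒≥ f≮d)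
        (degenerate-clique-bound s (S - v) (suc-injective (trans (sym (∣S∣≡1+∣S-v∣ S v∈S)) ∣S∣≡1+s))) e≡

    degenerate-graph-bound : ∀ {f} → edgeCount G ≡ d C 2 + f →
                             d * (cliqueCount G + d) + f ≤ d * (n + 2 ^ d) + f * 2 ^ d
    degenerate-graph-bound {f} m≡ =
      subst (λ c → d * (c + d) + f ≤ d * (n + 2 ^ d) + f * 2 ^ d) cliquesIn-all
        (degenerate-clique-bound n (λ _ → true) (∣all∣≡n n) f (trans edgesIn-all m≡))

open import Data.Integer using (ℤ; +_; _+_; _-_; _*_; _≤_; 0ℤ; +≤+)
open import Data.Integer.Properties
  using (pos-*; +-mono-≤; +-inverseʳ; +-identityʳ; *-zeroʳ; i≤j⇒0≤j-i; 0≤i-j⇒j≤i; module ≤-Reasoning)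
open import Data.Integer.Tactic.RingSolver using (solve-∀)
import Data.Nat as ℕ
import Data.Nat.Properties as ℕ
open import Data.Product using (_,_)
open import Relation.Binary.PropositionalEquality using (_≡_; refl; sym; trans; subst₂; cong; cong₂)
open Arithmetic using (2*nC2+n≡n*n)

-- The integer slack is twice the natural one plus (2^d - 1)(2 (d C 2) + d - d²), which vanishes.
integer-form : ∀ {d c n f m} →
  d ℕ.* (c ℕ.+ d) ℕ.+ f ℕ.≤ d ℕ.* (n ℕ.+ 2 ^ℕ d) ℕ.+ f ℕ.* 2 ^ℕ d → d C 2 ℕ.+ f ≡ m →
  (+ 2 * + d) * + c ≤ (+ 2 * + d) * + n + + 2 * (+ (2 ^ℕ d) - + 1) * + m - + d * (((+ d - + 3) * + (2 ^ℕ d)) + + d + + 1)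
integer-form {d} {c} {n} {f} h refl = 0≤i-j⇒j≤i (begin
  0ℤ                                           ≤⟨ +-mono-≤ (i≤j⇒0≤j-i L≤R) (i≤j⇒0≤j-i L≤R) ⟩
  (R - L) + (R - L)                            ≡⟨ +-identityʳ _ ⟨
  (R - L) + (R - L) + 0ℤ                       ≡⟨ cong (λ z → (R - L) + (R - L) + z) (*-zeroʳ (+ X - + 1)) ⟨
  (R - L) + (R - L) + (+ X - + 1) * 0ℤ         ≡⟨ cong (λ z → (R - L) + (R - L) + (+ X - + 1) * z) 2b+d-d*d≡0 ⟨
  (R - L) + (R - L) + (+ X - + 1) * (+ 2 * + b + + d - + d * + d)
                                               ≡⟨ rearrange (+ c) (+ n) (+ f) (+ d) (+ X) (+ b) ⟨
  (+ 2 * + d) * + n + + 2 * (+ X - + 1) * (+ b + + f) - + d * (((+ d - + 3) * + X) + + d + + 1) - (+ 2 * + d) * + c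
                                               ∎)
  where
  open ≤-Reasoning
  X = 2 ^ℕ d
  b = d C 2
  L R : ℤ
  L = + d * (+ c + + d) + + f
  R = + d * (+ n + + X) + + f * + X
  L≤R : L ≤ R
  L≤R = subst₂ _≤_ (cong (_+ + f) (pos-* d (c ℕ.+ d))) (cong₂ _+_ (pos-* d (n ℕ.+ X)) (pos-* f X)) (+≤+ h)
  2b+d≡d*d : + 2 * + b + + d ≡ + d * + d
  2b+d≡d*d = trans (cong (_+ + d) (sym (pos-* 2 b))) (trans (cong +_ (2*nC2+n≡n*n d)) (pos-* d d))
  2b+d-d*d≡0 : + 2 * + b + + d - + d * + d ≡ 0ℤ
  2b+d-d*d≡0 = trans (cong (_- + d * + d) 2b+d≡d*d) (+-inverseʳ (+ d * + d))
  rearrange : ∀ c n f d X b →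
    (+ 2 * d) * n + + 2 * (X - + 1) * (b + f) - d * (((d - + 3) * X) + d + + 1) - (+ 2 * d) * c
      ≡ (d * (n + X) + f * X - (d * (c + d) + f)) + (d * (n + X) + f * X - (d * (c + d) + f))
        + (X - + 1) * (+ 2 * b + d - d * d)
  rearrange = solve-∀

theorem4 : (d : ℕ) → d ≥ 1 → (n : ℕ) → (G : Graph n) → Degenerate d G →
    edgeCount G ≥ d C 2 →
    (+ 2 * + d) * + cliqueCount G
      ≤ (+ 2 * + d) * + n + + 2 * (+ (2 ^ℕ d) - + 1) * + edgeCount G
        - + d * (((+ d - + 3) * + (2 ^ℕ d)) + + d + + 1)
theorem4 d d≥1 n G G-degenerate m≥dC2 =
  let f , dC2+f≡m = ℕ.m≤n⇒∃[o]m+o≡n m≥dC2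
  in  integer-form {d} {cliqueCount G} {n} {f}
        (CliqueBounds.degenerate-graph-bound G G-degenerate d≥1 (sym dC2+f≡m)) dC2+f≡m
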